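{- Let $g:\mathbb{N}\to\{0,1\}$ be defined by $g(0)=1$, $g(1)=0$ and, for $n\ge 2$, \[ g(n)=\begin{cases}1-g(m), & \text{if } \lfloor n\phi\rfloor=\lfloor m(\phi+1)\rfloor+1 \text{ for some } m\ge 0,\\ 1, & \text{otherwise,}\end{cases} \] where $\phi=(1+\sqrt5)/2$. Then $g$ is Fibonacci-automatic. More precisely, let $\mu$ be the morphism on the alphabet $\{0,1,2,3,4,5\}$ given by $0\mapsto 01$, $1\mapsto 2$, $2\mapsto 31$, $3\mapsto 45$, $4\mapsto 35$, $5\mapsto 4$, and let $\mathcal{A}$ be the DFA over the input alphabet $\{0,1\}$ with state set $\{0,1,2,3,4,5\}$, initial state $0$, accepting states $\{0,2,3,5\}$, and transitions defined as follows: if $\mu(c)=de$ (two letters) there is an edge $c\to d$ labelled $0$ and an edge $c\to e$ labelled $1$; if $\mu(c)=d$ (one letter) there is only an edge $c\to d$ labelled $0$. Then for every $n\ge 0$, $\mathcal{A}$ accepts $\mathrm{rep}_F(n)$ (read most significant digit first) if and only if $g(n)=1$.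
   Context: The Fibonacci sequence is $F_0=1$, $F_1=2$, $F_{n+2}=F_{n+1}+F_n$. For $n>0$, $\mathrm{rep}_F(n)$ is the greedy (Zeckendorf) representation of $n$: the unique word $d_k\cdots d_0$ over $\{0,1\}$ with $n=\sum_{i=0}^k d_iF_i$, $d_k\ne 0$ and no two consecutive $1$'s; $\mathrm{rep}_F(0)$ is the empty word. A sequence $u:\mathbb{N}\to\Delta$ is Fibonacci-automatic if there is a deterministic finite automaton with output which, on input $\mathrm{rep}_F(n)$, outputs $u(n)$. -}

module Defs where

open import Data.Nat using (ℕ; zero; suc; _+_; _*_; _∸_; _^_; _≤_; _<_; _≥_)
open import Data.Bool using (Bool; true; false)
open import Data.Fin using (Fin; zero; suc)
open import Data.List using (List; []; _∷_; length)
open import Data.Maybe using (Maybe; just; nothing)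
open import Data.Product using (Σ; ∃; _×_; _,_)
open import Data.Unit using (⊤)
open import Data.Empty using (⊥)
open import Relation.Nullary using (¬_)
open import Relation.Binary.PropositionalEquality using (_≡_)

-- Real numbers of the form n·φ and m·(φ+1), φ = (1+√5)/2, handled via
-- their lower cuts { k ∈ ℕ | k ≤ x }.

-- k ≤ n·φ  ⇔  2k − n ≤ n√5  ⇔  (2k ∸ n)² ≤ 5n²
-- (if 2k ≤ n the truncated difference is 0 and both sides hold).
_≤nφ_ : ℕ → ℕ → Set
k ≤nφ n = (2 * k ∸ n) ^ 2 ≤ 5 * n ^ 2

-- k ≤ m·(φ+1) = m(3+√5)/2  ⇔  2k − 3m ≤ m√5  ⇔  (2k ∸ 3m)² ≤ 5m²
_≤m[φ+1]_ : ℕ → ℕ → Set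
k ≤m[φ+1] m = (2 * k ∸ 3 * m) ^ 2 ≤ 5 * m ^ 2

IsFloor : (ℕ → Set) → ℕ → Set
IsFloor P k = P k × ¬ P (suc k)

-- ⌊n φ⌋ = ⌊m(φ+1)⌋ + 1
FloorCond : ℕ → ℕ → Set
FloorCond n m = Σ ℕ λ b → IsFloor (λ k → k ≤m[φ+1] m) b × IsFloor (λ k → k ≤nφ n) (suc b)

IsG : (ℕ → ℕ) → Set
IsG g =
  (∀ n → g n ≤ 1) ×
  g 0 ≡ 1 ×
  g 1 ≡ 0 ×
  (∀ n → n ≥ 2 → ∀ m → FloorCond n m → g n ≡ 1 ∸ g m) ×
  (∀ n → n ≥ 2 → (∀ m → ¬ FloorCond n m) → g n ≡ 1)

F : ℕ → ℕ
F zero = 1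
F (suc zero) = 2
F (suc (suc n)) = F (suc n) + F n

-- Words over {0,1}, most significant digit first (true = 1).
value : List Bool → ℕ
value [] = 0
value (false ∷ w) = value w
value (true ∷ w) = F (length w) + value w

NoTwoConsecutiveOnes : List Bool → Set
NoTwoConsecutiveOnes [] = ⊤
NoTwoConsecutiveOnes (true ∷ true ∷ w) = ⊥
NoTwoConsecutiveOnes (_ ∷ w) = NoTwoConsecutiveOnes w

LeadingNonzero : List Bool → Set
LeadingNonzero [] = ⊤
LeadingNonzero (d ∷ _) = d ≡ true

-- w = rep_F(n) (the empty word for n = 0).
IsRepF : List Bool → ℕ → Set
IsRepF w n = value w ≡ n × LeadingNonzero w × NoTwoConsecutiveOnes w

μ : Fin 6 → List (Fin 6)
μ zero = zero ∷ suc zero ∷ []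
μ (suc zero) = suc (suc zero) ∷ []
μ (suc (suc zero)) = suc (suc (suc zero)) ∷ suc zero ∷ []
μ (suc (suc (suc zero))) =
  suc (suc (suc (suc zero))) ∷ suc (suc (suc (suc (suc zero)))) ∷ []
μ (suc (suc (suc (suc zero)))) =
  suc (suc (suc zero)) ∷ suc (suc (suc (suc (suc zero)))) ∷ []
μ (suc (suc (suc (suc (suc zero))))) = suc (suc (suc (suc zero))) ∷ []

letterAt : List (Fin 6) → ℕ → Maybe (Fin 6)
letterAt [] _ = nothing
letterAt (x ∷ _) zero = just x
letterAt (_ ∷ xs) (suc i) = letterAt xs i

δ : Fin 6 → Bool → Maybe (Fin 6)
δ c false = letterAt (μ c) 0
δ c true = letterAt (μ c) 1

-- run from a state; nothing = no transition (the word is rejected)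
run : Fin 6 → List Bool → Maybe (Fin 6)
run q [] = just q
run q (b ∷ w) with δ q b
... | nothing = nothing
... | just q' = run q' w

Accepting : Fin 6 → Set
Accepting zero = ⊤
Accepting (suc zero) = ⊥
Accepting (suc (suc zero)) = ⊤
Accepting (suc (suc (suc zero))) = ⊤
Accepting (suc (suc (suc (suc zero)))) = ⊥
Accepting (suc (suc (suc (suc (suc zero))))) = ⊤

AcceptsFrom : Maybe (Fin 6) → Set
AcceptsFrom nothing = ⊥
AcceptsFrom (just q) = Accepting q

Accepts : List Bool → Set
Accepts w = AcceptsFrom (run zero w)

{-# OPTIONS --safe #-}
-- Write N = value w and S = value (w ∷ʳ false) for the word w read so far; appending the
-- digit 0 maps (N, S) to (S, S + N), appending 1 maps it to (S + 1, S + N + 2). Along every run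
-- of 𝒜 one has S = ⌊Nφ⌋ + 1 in the states 1, 3, 5 and S = ⌊Nφ⌋ in the states 0, 2, 4; with
-- suitable polynomial side conditions on (N, S) this is an inductive invariant. As
-- ⌊m(φ+1)⌋ = ⌊mφ⌋ + m, the condition ⌊nφ⌋ = ⌊m(φ+1)⌋ + 1 then holds, with m the value of the
-- word one digit shorter, on each of the edges 1→2, 3→4, 5→4, 2→1, 4→5, and these swap
-- accepting and rejecting states. On the remaining edges 2→3, 4→3, 3→5, all into accepting
-- states, no m satisfies it: for the Zeckendorf word x of m it would give value (w0) = value (x01)
-- or value (w0) = value (x10), and uniqueness of Zeckendorf representations rules out both.
module Submission where

open import Algebra.Properties.CommutativeSemigroup using (interchange; x∙yz≈y∙xz)
open import Data.Bool using (Bool; true; false)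
open import Data.Empty using (⊥; ⊥-elim)
open import Data.Fin using (Fin; zero; suc)
open import Data.List using (List; []; _∷_; _∷ʳ_; _++_; length; replicate)
open import Data.List.Properties
  using (length-++; length-++-comm; length-replicate; ++-assoc; ∷ʳ-injective)
open import Data.List.Reverse using (Reverse; []; _∶_∶ʳ_; reverseView)
open import Data.Maybe using (just; nothing; _>>=_)
open import Data.Maybe.Properties using (just-injective)
open import Data.Nat using (ℕ; zero; suc; _+_; _*_; _∸_; _^_; _≤_; _<_; z≤n; s≤s; _<?_)
open import Data.Nat.Induction using (<-rec)
open import Data.Nat.Properties
open import Data.Nat.Tactic.RingSolver using (solve)
open import Data.Product using (Σ; _×_; _,_; proj₁; proj₂)
open import Data.Sum using (_⊎_; inj₁; inj₂)
open import Data.Unit using (tt)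
open import Function.Base using (id)
open import Function.Bundles using (_⇔_; mk⇔; Equivalence)
open import Relation.Binary.Definitions using (tri<; tri≈; tri>)
open import Relation.Binary.PropositionalEquality
open import Relation.Nullary using (¬_; yes; no)

open import Defs

-- Without subtraction, each polynomial inequality below is obtained from a sum Y ≤ X of
-- hypotheses and an identity L + X + k ≡ R + Y checked by the ring solver.
≤-by-identity : ∀ {L R X Y} k → Y ≤ X → L + X + k ≡ R + Y → L ≤ R
≤-by-identity {L} {R} {X} {Y} k Y≤X eq = +-cancelʳ-≤ X L R (begin
  L + X     ≤⟨ m≤m+n (L + X) k ⟩
  L + X + k ≡⟨ eq ⟩
  R + Y     ≤⟨ +-monoʳ-≤ R Y≤X ⟩
  R + X     ∎)
  where open ≤-Reasoning

x^2≡x*x : ∀ x → x ^ 2 ≡ x * x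
x^2≡x*x x = cong (x *_) (*-identityʳ x)

golden-identity : ∀ j n k → j + n ≡ 2 * k →
                  4 * (k * k) + 5 * (n * n) ≡ 4 * (k * n + n * n) + j * j
golden-identity j n k j+n≡2k = begin
  4 * (k * k) + 5 * (n * n)                ≡⟨ solve (k ∷ n ∷ []) ⟩
  (2 * k) * (2 * k) + 5 * (n * n)          ≡⟨ cong (λ t → t * t + 5 * (n * n)) (sym j+n≡2k) ⟩
  (j + n) * (j + n) + 5 * (n * n)          ≡⟨ solve (j ∷ n ∷ []) ⟩
  2 * n * (j + n) + 4 * (n * n) + j * j    ≡⟨ cong (λ t → 2 * n * t + 4 * (n * n) + j * j) j+n≡2k ⟩
  2 * n * (2 * k) + 4 * (n * n) + j * j    ≡⟨ solve (k ∷ n ∷ j ∷ []) ⟩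
  4 * (k * n + n * n) + j * j              ∎
  where open ≡-Reasoning

≤nφ⇔ : ∀ k n → k ≤nφ n ⇔ k * k ≤ k * n + n * n
≤nφ⇔ k n with ≤-total (2 * k) n
... | inj₁ 2k≤n rewrite m≤n⇒m∸n≡0 2k≤n = mk⇔ (λ _ → k²≤kn+n²) (λ _ → z≤n)
  where
  k≤n : k ≤ n
  k≤n = ≤-trans (m≤m+n k (k + 0)) 2k≤n
  k²≤kn+n² : k * k ≤ k * n + n * n
  k²≤kn+n² = ≤-trans (*-monoʳ-≤ k k≤n) (m≤m+n (k * n) (n * n))
... | inj₂ n≤2k rewrite x^2≡x*x (2 * k ∸ n) | x^2≡x*x n = mk⇔
  (λ j²≤5n² → *-cancelˡ-≤ 4 (≤-by-identity 0 j²≤5n² (trans (+-identityʳ _) key)))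
  (λ k²≤kn+n² → ≤-by-identity 0 (*-monoʳ-≤ 4 k²≤kn+n²) (trans (+-identityʳ _) key′))
  where
  j = 2 * k ∸ n
  key : 4 * (k * k) + 5 * (n * n) ≡ 4 * (k * n + n * n) + j * j
  key = golden-identity j n k (m∸n+n≡m n≤2k)
  key′ : j * j + 4 * (k * n + n * n) ≡ 5 * (n * n) + 4 * (k * k)
  key′ = trans (+-comm (j * j) _) (trans (sym key) (+-comm (4 * (k * k)) _))

DownClosed : (ℕ → Set) → Set
DownClosed P = ∀ {i j} → i ≤ j → P j → P i

floor-unique : ∀ P {a b} → DownClosed P → IsFloor P a → IsFloor P b → a ≡ b
floor-unique P {a} {b} down (Pa , ¬Pa+1) (Pb , ¬Pb+1) with <-cmp a b
... | tri< a<b _ _ = ⊥-elim (¬Pa+1 (down a<b Pb))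
... | tri≈ _ a≡b _ = a≡b
... | tri> _ _ b<a = ⊥-elim (¬Pb+1 (down b<a Pa))

cut-downClosed : ∀ c X → DownClosed (λ k → (2 * k ∸ c) ^ 2 ≤ X)
cut-downClosed c X i≤j = ≤-trans (^-monoˡ-≤ 2 (∸-monoˡ-≤ c (*-monoʳ-≤ 2 i≤j)))

≤nφ-downClosed : ∀ n → DownClosed (_≤nφ n)
≤nφ-downClosed n = cut-downClosed n (5 * n ^ 2)

≤m[φ+1]-downClosed : ∀ m → DownClosed (_≤m[φ+1] m)
≤m[φ+1]-downClosed m = cut-downClosed (3 * m) (5 * m ^ 2)

floor-by-squares : ∀ {s N} → s * s ≤ s * N + N * N → suc s * N + N * N < suc s * suc s →
                   IsFloor (_≤nφ N) s
floor-by-squares {s} {N} below above =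
  Equivalence.from (≤nφ⇔ s N) below , λ h → <⇒≱ above (Equivalence.to (≤nφ⇔ (suc s) N) h)

≤m[φ+1]-+ : ∀ a m → (a + m) ≤m[φ+1] m ≡ a ≤nφ m
≤m[φ+1]-+ a m = cong (λ t → t ^ 2 ≤ 5 * m ^ 2) (begin
  2 * (a + m) ∸ 3 * m        ≡⟨ cong₂ _∸_ 2[a+m] 3m ⟩
  2 * m + 2 * a ∸ (2 * m + m) ≡⟨ [m+n]∸[m+o]≡n∸o (2 * m) (2 * a) m ⟩
  2 * a ∸ m                  ∎)
  where
  open ≡-Reasoning
  2[a+m] : 2 * (a + m) ≡ 2 * m + 2 * a
  2[a+m] = solve (a ∷ m ∷ [])
  3m : 3 * m ≡ 2 * m + m
  3m = solve (m ∷ [])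

floor-m[φ+1] : ∀ m {a} → IsFloor (_≤nφ m) a → IsFloor (_≤m[φ+1] m) (a + m)
floor-m[φ+1] m {a} (below , ¬above) =
  subst id (sym (≤m[φ+1]-+ a m)) below , λ h → ¬above (subst id (≤m[φ+1]-+ (suc a) m) h)

-- Lower N S and Upper N S strengthen S = ⌊Nφ⌋ + 1 and S = ⌊Nφ⌋ (lower-floorGap, upper-floorGap)
-- to conditions preserved by the steps (N, S) ↦ (S, S + N) and (N, S) ↦ (S + 1, S + N + 2).
Lin : ℕ → ℕ → Set
Lin N S = 1 ≤ N × N < S × S ≤ 2 * N × 4 * N < 3 * S

Lower Upper : ℕ → ℕ → Set
Lower N S = Lin N S × S * N + N * N < S * S × S * S + S ≤ S * N + N * N + 3 * N
Upper N S = Lin N S × S * S < S * N + N * N × S * N + N * N + 4 * N ≤ S * S + 3 * S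

lin-2≤S : ∀ {N S} → Lin N S → 2 ≤ S
lin-2≤S (1≤N , N<S , _) = ≤-trans (s≤s 1≤N) N<S

lin-S≤3N : ∀ {N S} → Lin N S → S ≤ 3 * N
lin-S≤3N {N} (_ , _ , S≤2N , _) = ≤-trans S≤2N (*-monoˡ-≤ N (n≤1+n 2))

lin-step₀ : ∀ {N S} → Lin N S → Lin S (S + N)
lin-step₀ {N} {S} (1≤N , N<S , S≤2N , _) =
  ≤-trans 1≤N (<⇒≤ N<S) ,
  ≤-by-identity 0 1≤N (solve (S ∷ N ∷ [])) ,
  ≤-by-identity 0 (<⇒≤ N<S) (solve (S ∷ N ∷ [])) ,
  ≤-by-identity 0 (+-mono-≤ S≤2N 1≤N) (solve (S ∷ N ∷ []))

lin-step₁ : ∀ {N S} → Lin N S → Lin (suc S) (suc (suc (S + N)))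
lin-step₁ {N} {S} lin@(_ , N<S , _) =
  s≤s z≤n ,
  s≤s (s≤s (m≤m+n S N)) ,
  ≤-by-identity 0 (<⇒≤ N<S) (solve (S ∷ N ∷ [])) ,
  ≤-by-identity 1 (lin-S≤3N lin) (solve (S ∷ N ∷ []))

lower-step₀ : ∀ {N S} → Lower N S → Upper S (S + N)
lower-step₀ {N} {S} (lin , below , above) =
  lin-step₀ lin ,
  ≤-by-identity 0 below (solve (S ∷ N ∷ [])) ,
  ≤-by-identity 0 above (solve (S ∷ N ∷ []))

upper-step₀ : ∀ {N S} → Upper N S → Lower S (S + N)
upper-step₀ {N} {S} (lin , below , above) =
  lin-step₀ lin ,
  ≤-by-identity 0 below (solve (S ∷ N ∷ [])) ,
  ≤-by-identity 0 (+-mono-≤ above (lin-S≤3N lin)) (solve (S ∷ N ∷ []))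

lower-step₁ : ∀ {N S} → Lower N S → Lower (suc S) (suc (suc (S + N)))
lower-step₁ {N} {S} (lin@(_ , _ , _ , 4N<3S) , below , above) =
  lin-step₁ lin ,
  ≤-by-identity 0 above (solve (S ∷ N ∷ [])) ,
  ≤-by-identity 2 (+-mono-≤ below 4N<3S) (solve (S ∷ N ∷ []))

upper-step₁ : ∀ {N S} → Upper N S → Lower (suc S) (suc (suc (S + N)))
upper-step₁ {N} {S} (lin , below , above) =
  lin-step₁ lin ,
  ≤-by-identity 1 (+-mono-≤ below (lin-S≤3N lin)) (solve (S ∷ N ∷ [])) ,
  ≤-by-identity 0 above (solve (S ∷ N ∷ []))

record FloorGap (N S g : ℕ) : Set where
  constructor floorGap
  field
    ⌊Nφ⌋ : ℕ
    ⌊Nφ⌋-isFloor : IsFloor (_≤nφ N) ⌊Nφ⌋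
    S≡g+⌊Nφ⌋ : S ≡ g + ⌊Nφ⌋

origin-floorGap : FloorGap 0 0 0
origin-floorGap = floorGap 0 (z≤n , λ ()) refl

lower-floorGap : ∀ {N S} → Lower N S → FloorGap N S 1
lower-floorGap {N} {suc s} ((_ , _ , _ , 4N<3S) , below , above) = floorGap s ⌊Nφ⌋ refl
  where
  ⌊Nφ⌋ = floor-by-squares {s} {N}
           (≤-by-identity 0 (+-mono-≤ above 4N<3S) (solve (s ∷ N ∷ []))) below

upper-floorGap : ∀ {N S} → Upper N S → FloorGap N S 0
upper-floorGap {N} {S} (lin , below , above) = floorGap S ⌊Nφ⌋ refl
  where
  ⌊Nφ⌋ = floor-by-squares {S} {N} (<⇒≤ below)
           (≤-by-identity 0 (+-mono-≤ above (lin-S≤3N lin)) (solve (S ∷ N ∷ [])))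

floorCond-step₀ : ∀ {N S} → FloorGap N S 1 → FloorGap S (S + N) 0 → FloorCond S N
floorCond-step₀ {N} (floorGap f ⌊Nφ⌋ refl) (floorGap _ ⌊Sφ⌋ refl) =
  f + N , floor-m[φ+1] N ⌊Nφ⌋ , ⌊Sφ⌋

floorCond-step₁ : ∀ {N S} → FloorGap N S 0 → FloorGap (suc S) (suc (suc (S + N))) 1 →
                  FloorCond (suc S) N
floorCond-step₁ {N} (floorGap f ⌊Nφ⌋ refl) (floorGap _ ⌊[S+1]φ⌋ refl) =
  f + N , floor-m[φ+1] N ⌊Nφ⌋ , ⌊[S+1]φ⌋

floorCond-shift : ∀ {n s m t g} → FloorGap n s 1 → FloorCond n m → FloorGap m t g →
                  g + s ≡ suc (suc (t + m))
floorCond-shift {n} {m = m} {g = g}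
  (floorGap fw ⌊nφ⌋ refl) (b , ⌊m[φ+1]⌋ , ⌊nφ⌋′) (floorGap f ⌊mφ⌋ refl) = begin
    g + suc fw             ≡⟨ cong (λ k → g + suc k) fw≡1+b ⟩
    g + suc (suc b)        ≡⟨ cong (λ k → g + suc (suc k)) b≡f+m ⟩
    g + suc (suc (f + m))  ≡⟨ solve (g ∷ f ∷ m ∷ []) ⟩
    suc (suc (g + f + m))  ∎
  where
  open ≡-Reasoning
  fw≡1+b : fw ≡ suc b
  fw≡1+b = floor-unique (_≤nφ n) (≤nφ-downClosed n) ⌊nφ⌋ ⌊nφ⌋′
  b≡f+m : b ≡ f + m
  b≡f+m = floor-unique (_≤m[φ+1] m) (≤m[φ+1]-downClosed m) ⌊m[φ+1]⌋ (floor-m[φ+1] m ⌊mφ⌋)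

shift : List Bool → ℕ
shift w = value (w ∷ʳ false)

value-flip : ∀ w v → value (w ++ true ∷ v) ≡ F (length v) + value (w ++ false ∷ v)
value-flip [] v = refl
value-flip (false ∷ w) v = value-flip w v
value-flip (true ∷ w) v
  rewrite length-++ w {true ∷ v} | length-++ w {false ∷ v} | value-flip w v =
  x∙yz≈y∙xz +-commutativeSemigroup (F (length w + suc (length v))) (F (length v)) _

value-++-00 : ∀ w → value (w ++ false ∷ false ∷ []) ≡ shift w + value w
value-++-00 [] = refl
value-++-00 (false ∷ w) = value-++-00 w
value-++-00 (true ∷ w)
  rewrite length-++-comm w (false ∷ false ∷ []) | length-++-comm w (false ∷ []) | value-++-00 w =
  interchange +-commutativeSemigroup (F (suc (length w))) (F (length w)) (shift w) (value w)

value-∷ʳ-true : ∀ w → value (w ∷ʳ true) ≡ suc (shift w)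
value-∷ʳ-true w = value-flip w []

shift-∷ʳ-false : ∀ w → shift (w ∷ʳ false) ≡ shift w + value w
shift-∷ʳ-false w = trans (cong value (++-assoc w _ _)) (value-++-00 w)

shift-∷ʳ-true : ∀ w → shift (w ∷ʳ true) ≡ suc (suc (shift w + value w))
shift-∷ʳ-true w = begin
  value ((w ∷ʳ true) ∷ʳ false)       ≡⟨ cong value (++-assoc w _ _) ⟩
  value (w ++ true ∷ false ∷ [])     ≡⟨ value-flip w (false ∷ []) ⟩
  2 + value (w ++ false ∷ false ∷ []) ≡⟨ cong (2 +_) (value-++-00 w) ⟩
  2 + (shift w + value w)            ∎
  where open ≡-Reasoning

NoTwoConsecutiveOnes-tail : ∀ b w → NoTwoConsecutiveOnes (b ∷ w) → NoTwoConsecutiveOnes w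
NoTwoConsecutiveOnes-tail false w h = h
NoTwoConsecutiveOnes-tail true [] h = tt
NoTwoConsecutiveOnes-tail true (false ∷ w) h = h

NoTwoConsecutiveOnes-∷ʳ-false : ∀ w → NoTwoConsecutiveOnes w → NoTwoConsecutiveOnes (w ∷ʳ false)
NoTwoConsecutiveOnes-∷ʳ-false [] h = tt
NoTwoConsecutiveOnes-∷ʳ-false (false ∷ w) h = NoTwoConsecutiveOnes-∷ʳ-false w h
NoTwoConsecutiveOnes-∷ʳ-false (true ∷ []) h = tt
NoTwoConsecutiveOnes-∷ʳ-false (true ∷ false ∷ w) h = NoTwoConsecutiveOnes-∷ʳ-false w h

NoTwoConsecutiveOnes-∷ʳ-01 : ∀ w → NoTwoConsecutiveOnes w →
                             NoTwoConsecutiveOnes (w ∷ʳ false ∷ʳ true)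
NoTwoConsecutiveOnes-∷ʳ-01 [] h = tt
NoTwoConsecutiveOnes-∷ʳ-01 (false ∷ w) h = NoTwoConsecutiveOnes-∷ʳ-01 w h
NoTwoConsecutiveOnes-∷ʳ-01 (true ∷ []) h = tt
NoTwoConsecutiveOnes-∷ʳ-01 (true ∷ false ∷ w) h = NoTwoConsecutiveOnes-∷ʳ-01 w h

F-mono : ∀ n → F n ≤ F (suc n)
F-mono zero = n≤1+n 1
F-mono (suc n) = m≤m+n (F (suc n)) (F n)

n<F : ∀ n → n < F n
n<F zero = s≤s z≤n
n<F (suc zero) = s≤s (s≤s z≤n)
n<F (suc (suc n)) = ≤-<-trans (n<F (suc n)) (m<m+n (F (suc n)) (≤-<-trans z≤n (n<F n)))

value<F-length : ∀ w → NoTwoConsecutiveOnes w → value w < F (length w)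
value<F-length [] h = s≤s z≤n
value<F-length (false ∷ w) h = <-≤-trans (value<F-length w h) (F-mono (length w))
value<F-length (true ∷ []) h = s≤s (s≤s z≤n)
value<F-length (true ∷ false ∷ w) h = +-monoʳ-< (F (suc (length w))) (value<F-length w h)

same-length-unique : ∀ p q → NoTwoConsecutiveOnes p → NoTwoConsecutiveOnes q →
                     length p ≡ length q → value p ≡ value q → p ≡ q
same-length-unique [] [] _ _ _ _ = refl
same-length-unique (false ∷ p) (false ∷ q) hp hq l e =
  cong (false ∷_) (same-length-unique p q hp hq (suc-injective l) e)
same-length-unique (true ∷ p) (true ∷ q) hp hq l e =
  cong (true ∷_) (same-length-unique p q
    (NoTwoConsecutiveOnes-tail true p hp) (NoTwoConsecutiveOnes-tail true q hq) |p|≡|q|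
    (+-cancelˡ-≡ (F (length p)) _ _ (trans e (cong (λ n → F n + value q) (sym |p|≡|q|)))))
  where |p|≡|q| = suc-injective l
same-length-unique (true ∷ p) (false ∷ q) hp hq l e = ⊥-elim (<⇒≱ (value<F-length q hq) (begin
    F (length q)           ≡⟨ cong F (suc-injective l) ⟨
    F (length p)           ≤⟨ m≤m+n (F (length p)) (value p) ⟩
    F (length p) + value p ≡⟨ e ⟩
    value q                ∎))
  where open ≤-Reasoning
same-length-unique (false ∷ p) (true ∷ q) hp hq l e =
  sym (same-length-unique (true ∷ q) (false ∷ p) hq hp (sym l) (sym e))

pad : ℕ → List Bool → List Bool
pad k w = replicate k false ++ w

infix 4 _≈₀_
_≈₀_ : List Bool → List Bool → Set
p ≈₀ q = Σ ℕ λ k → pad k p ≡ q ⊎ p ≡ pad k q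

length-pad : ∀ k w → length (pad k w) ≡ k + length w
length-pad k w = trans (length-++ (replicate k false)) (cong (_+ length w) (length-replicate k))

value-pad : ∀ k w → value (pad k w) ≡ value w
value-pad zero w = refl
value-pad (suc k) w = value-pad k w

pad-admissible : ∀ k w → NoTwoConsecutiveOnes w → NoTwoConsecutiveOnes (pad k w)
pad-admissible zero w h = h
pad-admissible (suc k) w h = pad-admissible k w h

pad-∷ʳ : ∀ k w (b : Bool) → pad k (w ∷ʳ b) ≡ pad k w ∷ʳ b
pad-∷ʳ k w b = sym (++-assoc (replicate k false) w (b ∷ []))

zeckendorf-unique : ∀ p q → NoTwoConsecutiveOnes p → NoTwoConsecutiveOnes q →
                    value p ≡ value q → p ≈₀ q
zeckendorf-unique p q hp hq e with ≤-total (length p) (length q)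
... | inj₁ p≤q = k , inj₁ (same-length-unique (pad k p) q (pad-admissible k p hp) hq
                             (trans (length-pad k p) (m∸n+n≡m p≤q)) (trans (value-pad k p) e))
  where k = length q ∸ length p
... | inj₂ q≤p = k , inj₂ (same-length-unique p (pad k q) hp (pad-admissible k q hq)
                             (sym (trans (length-pad k q) (m∸n+n≡m q≤p))) (trans e (sym (value-pad k q))))
  where k = length p ∸ length q

≈₀-∷ʳ⁻ : ∀ {p q a b} → p ∷ʳ a ≈₀ q ∷ʳ b → p ≈₀ q × a ≡ b
≈₀-∷ʳ⁻ {p} {q} {a} (k , inj₁ e) with ∷ʳ-injective (pad k p) q (trans (sym (pad-∷ʳ k p a)) e)
... | p≡q , a≡b = (k , inj₁ p≡q) , a≡b
≈₀-∷ʳ⁻ {p} {q} {b = b} (k , inj₂ e) with ∷ʳ-injective p (pad k q) (trans e (pad-∷ʳ k q b))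
... | p≡q , a≡b = (k , inj₂ p≡q) , a≡b

Representable : ℕ → Set
Representable k =
  ∀ m → m < F k → Σ (List Bool) λ x → length x ≡ k × NoTwoConsecutiveOnes x × value x ≡ m

representable-suc-suc : ∀ {k} → Representable k → Representable (suc k) →
                        Representable (suc (suc k))
representable-suc-suc {k} rep rep′ m m<F with m <? F (suc k)
... | yes m<F′ with rep′ m m<F′
...   | x , l , h , v = false ∷ x , cong suc l , h , v
representable-suc-suc {k} rep rep′ m m<F | no m≮F′ with rep (m ∸ F (suc k)) m∸F<F
  where
  m∸F<F : m ∸ F (suc k) < F k
  m∸F<F = +-cancelˡ-< (F (suc k)) _ (F k)
            (subst (_< F (suc k) + F k) (sym (m+[n∸m]≡n (≮⇒≥ m≮F′))) m<F)
... | x , l , h , v =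
  true ∷ false ∷ x , cong (2 +_) l , h ,
  trans (cong₂ (λ n r → F (suc n) + r) l v) (m+[n∸m]≡n (≮⇒≥ m≮F′))

representable : ∀ k → Representable k
representable zero zero _ = [] , refl , tt , refl
representable zero (suc m) (s≤s ())
representable (suc zero) zero _ = false ∷ [] , refl , tt , refl
representable (suc zero) (suc zero) _ = true ∷ [] , refl , tt , refl
representable (suc zero) (suc (suc m)) (s≤s (s≤s ()))
representable (suc (suc k)) = representable-suc-suc (representable k) (representable (suc k))

zeckendorf-exists : ∀ m → Σ (List Bool) λ x → NoTwoConsecutiveOnes x × value x ≡ m
zeckendorf-exists m with representable m m (n<F m)
... | x , _ , h , v = x , h , v

pattern q0 = zero
pattern q1 = suc zero
pattern q2 = suc (suc zero)
pattern q3 = suc (suc (suc zero))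
pattern q4 = suc (suc (suc (suc zero)))
pattern q5 = suc (suc (suc (suc (suc zero))))

-- every edge into q is labelled entry q
entry : Fin 6 → Bool
entry q1 = true
entry q5 = true
entry _ = false

gap : Fin 6 → ℕ
gap q1 = 1
gap q3 = 1
gap q5 = 1
gap _ = 0

output : Fin 6 → ℕ
output q0 = 1
output q1 = 0
output q2 = 1
output q3 = 1
output q4 = 0
output q5 = 1

Accepting⇔output≡1 : ∀ q → Accepting q ⇔ output q ≡ 1
Accepting⇔output≡1 q0 = mk⇔ (λ _ → refl) (λ _ → tt)
Accepting⇔output≡1 q1 = mk⇔ (λ ()) (λ ())
Accepting⇔output≡1 q2 = mk⇔ (λ _ → refl) (λ _ → tt)
Accepting⇔output≡1 q3 = mk⇔ (λ _ → refl) (λ _ → tt)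
Accepting⇔output≡1 q4 = mk⇔ (λ ()) (λ ())
Accepting⇔output≡1 q5 = mk⇔ (λ _ → refl) (λ _ → tt)

gap-cases : ∀ q → gap q ≡ 0 ⊎ gap q ≡ 1
gap-cases q0 = inj₁ refl
gap-cases q1 = inj₂ refl
gap-cases q2 = inj₁ refl
gap-cases q3 = inj₂ refl
gap-cases q4 = inj₁ refl
gap-cases q5 = inj₂ refl

gap≡0⇒entry≡false : ∀ q → gap q ≡ 0 → entry q ≡ false
gap≡0⇒entry≡false q0 _ = refl
gap≡0⇒entry≡false q2 _ = refl
gap≡0⇒entry≡false q4 _ = refl
gap≡0⇒entry≡false q1 ()
gap≡0⇒entry≡false q3 ()
gap≡0⇒entry≡false q5 ()

entry-δ : ∀ q b {q′} → δ q b ≡ just q′ → entry q′ ≡ b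
entry-δ q0 false refl = refl
entry-δ q0 true refl = refl
entry-δ q1 false refl = refl
entry-δ q2 false refl = refl
entry-δ q2 true refl = refl
entry-δ q3 false refl = refl
entry-δ q3 true refl = refl
entry-δ q4 false refl = refl
entry-δ q4 true refl = refl
entry-δ q5 false refl = refl

δ-admissible : ∀ q b {q′} → δ q b ≡ just q′ → NoTwoConsecutiveOnes (entry q ∷ b ∷ [])
δ-admissible q0 false refl = tt
δ-admissible q0 true refl = tt
δ-admissible q1 false refl = tt
δ-admissible q2 false refl = tt
δ-admissible q2 true refl = tt
δ-admissible q3 false refl = tt
δ-admissible q3 true refl = tt
δ-admissible q4 false refl = tt
δ-admissible q4 true refl = tt
δ-admissible q5 false refl = tt

δ-total : ∀ q b → NoTwoConsecutiveOnes (entry q ∷ b ∷ []) →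
          Σ (Fin 6) λ q′ → δ q b ≡ just q′
δ-total q0 false _ = q0 , refl
δ-total q0 true _ = q1 , refl
δ-total q1 false _ = q2 , refl
δ-total q2 false _ = q3 , refl
δ-total q2 true _ = q1 , refl
δ-total q3 false _ = q4 , refl
δ-total q3 true _ = q5 , refl
δ-total q4 false _ = q3 , refl
δ-total q4 true _ = q5 , refl
δ-total q5 false _ = q4 , refl

NoTwoConsecutiveOnes-∷∷ : ∀ a b w → NoTwoConsecutiveOnes (a ∷ b ∷ []) →
                          NoTwoConsecutiveOnes (b ∷ w) → NoTwoConsecutiveOnes (a ∷ b ∷ w)
NoTwoConsecutiveOnes-∷∷ false b w _ h = h
NoTwoConsecutiveOnes-∷∷ true false w _ h = h

NoTwoConsecutiveOnes-take2 : ∀ a b w → NoTwoConsecutiveOnes (a ∷ b ∷ w) →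
                             NoTwoConsecutiveOnes (a ∷ b ∷ [])
NoTwoConsecutiveOnes-take2 false false w _ = tt
NoTwoConsecutiveOnes-take2 false true w _ = tt
NoTwoConsecutiveOnes-take2 true false w _ = tt

NoTwoConsecutiveOnes-[_] : ∀ b → NoTwoConsecutiveOnes (b ∷ [])
NoTwoConsecutiveOnes-[ false ] = tt
NoTwoConsecutiveOnes-[ true ] = tt

run-admissible : ∀ q w {q′} → run q w ≡ just q′ → NoTwoConsecutiveOnes (entry q ∷ w)
run-admissible q [] _ = NoTwoConsecutiveOnes-[ entry q ]
run-admissible q (b ∷ w) r with δ q b in eq
... | just q₁ = NoTwoConsecutiveOnes-∷∷ (entry q) b w (δ-admissible q b eq)
                  (subst (λ e → NoTwoConsecutiveOnes (e ∷ w)) (entry-δ q b eq) (run-admissible q₁ w r))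

run-total : ∀ q w → NoTwoConsecutiveOnes (entry q ∷ w) → Σ (Fin 6) λ q′ → run q w ≡ just q′
run-total q [] _ = q , refl
run-total q (b ∷ w) h with δ-total q b (NoTwoConsecutiveOnes-take2 (entry q) b w h)
... | q₁ , eq rewrite eq =
  run-total q₁ w (subst (λ e → NoTwoConsecutiveOnes (e ∷ w)) (sym (entry-δ q b eq))
                        (NoTwoConsecutiveOnes-tail (entry q) (b ∷ w) h))

run-∷ʳ : ∀ q w b → run q (w ∷ʳ b) ≡ (run q w >>= λ q′ → δ q′ b)
run-∷ʳ q [] b with δ q b
... | nothing = refl
... | just _ = refl
run-∷ʳ q (a ∷ w) b with δ q a
... | nothing = refl
... | just q′ = run-∷ʳ q′ w b

run-∷ʳ-just : ∀ {q} w b {q′} → run q w ≡ just q′ → run q (w ∷ʳ b) ≡ δ q′ b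
run-∷ʳ-just {q} w b r = trans (run-∷ʳ q w b) (cong (_>>= λ q′ → δ q′ b) r)

run-∷ʳ⁻ : ∀ {q} w b {q″} → run q (w ∷ʳ b) ≡ just q″ →
          Σ (Fin 6) λ q′ → run q w ≡ just q′ × δ q′ b ≡ just q″
run-∷ʳ⁻ {q} w b {q″} r = split (run q w) (trans (sym (run-∷ʳ q w b)) r)
  where
  split : ∀ m → (m >>= λ q′ → δ q′ b) ≡ just q″ →
          Σ (Fin 6) λ q′ → m ≡ just q′ × δ q′ b ≡ just q″
  split (just q′) eq = q′ , refl , eq

run-pad : ∀ k w → run q0 (pad k w) ≡ run q0 w
run-pad zero w = refl
run-pad (suc k) w = run-pad k w

≈₀-run : ∀ {p q} → p ≈₀ q → run q0 p ≡ run q0 q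
≈₀-run {p} (k , inj₁ refl) = sym (run-pad k p)
≈₀-run {q = q} (k , inj₂ refl) = run-pad k q

Invariant : Fin 6 → ℕ → ℕ → Set
Invariant q0 N S = N ≡ 0 × S ≡ 0
Invariant q1 = Lower
Invariant q2 = Upper
Invariant q3 = Lower
Invariant q4 = Upper
Invariant q5 = Lower

invariant-floorGap : ∀ q {N S} → Invariant q N S → FloorGap N S (gap q)
invariant-floorGap q0 (refl , refl) = origin-floorGap
invariant-floorGap q1 = lower-floorGap
invariant-floorGap q2 = upper-floorGap
invariant-floorGap q3 = lower-floorGap
invariant-floorGap q4 = upper-floorGap
invariant-floorGap q5 = lower-floorGap

invariant-δ₀ : ∀ q {q′ N S} → δ q false ≡ just q′ → Invariant q N S → Invariant q′ S (S + N)
invariant-δ₀ q0 refl (refl , refl) = refl , refl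
invariant-δ₀ q1 refl = lower-step₀
invariant-δ₀ q2 refl = upper-step₀
invariant-δ₀ q3 refl = lower-step₀
invariant-δ₀ q4 refl = upper-step₀
invariant-δ₀ q5 refl = lower-step₀

invariant-δ₁ : ∀ q {q′ N S} → δ q true ≡ just q′ → Invariant q N S →
               Invariant q′ (suc S) (suc (suc (S + N)))
invariant-δ₁ q0 refl (refl , refl) = (≤-refl , ≤-refl , ≤-refl , n≤1+n 5) , ≤-refl , ≤-refl
invariant-δ₁ q2 refl = upper-step₁
invariant-δ₁ q3 refl = lower-step₁
invariant-δ₁ q4 refl = upper-step₁
invariant-δ₁ q1 ()
invariant-δ₁ q5 ()

run-invariant′ : ∀ {w q} → Reverse w → run q0 w ≡ just q → Invariant q (value w) (shift w)
run-invariant′ [] refl = refl , refl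
run-invariant′ (u ∶ ru ∶ʳ b) r with run-∷ʳ⁻ u b r
run-invariant′ {q = q} (u ∶ ru ∶ʳ false) r | qu , r-u , eq =
  subst (Invariant q (shift u)) (sym (shift-∷ʳ-false u)) (invariant-δ₀ qu eq (run-invariant′ ru r-u))
run-invariant′ {q = q} (u ∶ ru ∶ʳ true) r | qu , r-u , eq =
  subst₂ (Invariant q) (sym (value-∷ʳ-true u)) (sym (shift-∷ʳ-true u))
    (invariant-δ₁ qu eq (run-invariant′ ru r-u))

run-invariant : ∀ w {q} → run q0 w ≡ just q → Invariant q (value w) (shift w)
run-invariant w = run-invariant′ (reverseView w)

run-floorGap : ∀ w {q} → run q0 w ≡ just q → FloorGap (value w) (shift w) (gap q)
run-floorGap w {q} r = invariant-floorGap q (run-invariant w r)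

shift≤value-∷ʳ : ∀ u d → shift u ≤ value (u ∷ʳ d)
shift≤value-∷ʳ u false = ≤-refl
shift≤value-∷ʳ u true = ≤-trans (n≤1+n (shift u)) (≤-reflexive (sym (value-∷ʳ-true u)))

∷ʳ-true-admissible : ∀ x {q} → run q0 x ≡ just q → gap q ≡ 0 → NoTwoConsecutiveOnes (x ∷ʳ true)
∷ʳ-true-admissible x {q} r gap≡0
  with δ-total q true
         (subst (λ e → NoTwoConsecutiveOnes (e ∷ true ∷ [])) (sym (gap≡0⇒entry≡false q gap≡0)) tt)
... | _ , eq = run-admissible q0 (x ∷ʳ true) (trans (run-∷ʳ-just x true r) eq)

no-lower-witness : ∀ w x → NoTwoConsecutiveOnes w → NoTwoConsecutiveOnes x →
                   shift w ≡ suc (shift x + value x) → ⊥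
no-lower-witness w x hw hx sw
  with ≈₀-∷ʳ⁻ (zeckendorf-unique (w ∷ʳ false) (x ∷ʳ false ∷ʳ true)
                 (NoTwoConsecutiveOnes-∷ʳ-false w hw) (NoTwoConsecutiveOnes-∷ʳ-01 x hx)
                 (trans sw (sym (trans (value-∷ʳ-true (x ∷ʳ false)) (cong suc (shift-∷ʳ-false x))))))
... | _ , ()

upper-witness : ∀ u d x → NoTwoConsecutiveOnes (u ∷ʳ d) → NoTwoConsecutiveOnes (x ∷ʳ true) →
                shift (u ∷ʳ d) ≡ suc (suc (shift x + value x)) → u ≈₀ x × d ≡ true
upper-witness u d x hw hx sw =
  ≈₀-∷ʳ⁻ (proj₁ (≈₀-∷ʳ⁻ (zeckendorf-unique (u ∷ʳ d ∷ʳ false) (x ∷ʳ true ∷ʳ false)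
    (NoTwoConsecutiveOnes-∷ʳ-false (u ∷ʳ d) hw) (NoTwoConsecutiveOnes-∷ʳ-false (x ∷ʳ true) hx)
    (trans sw (sym (shift-∷ʳ-true x))))))

lower-floorCond⇒upper-∷ʳ-true :
  ∀ u d {qu m} → NoTwoConsecutiveOnes (u ∷ʳ d) → run q0 u ≡ just qu →
  FloorGap (value (u ∷ʳ d)) (shift (u ∷ʳ d)) 1 → FloorCond (value (u ∷ʳ d)) m →
  d ≡ true × gap qu ≡ 0
lower-floorCond⇒upper-∷ʳ-true u d {qu} {m} hw ru gw fc with zeckendorf-exists m
... | x , hx , refl with run-total q0 x hx
... | qx , rx with gap-cases qx
... | inj₂ gap≡1 = ⊥-elim (no-lower-witness (u ∷ʳ d) x hw hx
                     (suc-injective (floorCond-shift gw fc (subst (FloorGap _ _) gap≡1 (run-floorGap x rx)))))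
... | inj₁ gap≡0 with upper-witness u d x hw (∷ʳ-true-admissible x rx gap≡0)
                        (floorCond-shift gw fc (subst (FloorGap _ _) gap≡0 (run-floorGap x rx)))
...   | u≈₀x , d≡true =
  d≡true , trans (cong gap (just-injective (trans (sym ru) (trans (≈₀-run u≈₀x) rx)))) gap≡0

g-flip-step₀ : ∀ {g N S o} → IsG g → Lower N S → (N < S → g N ≡ o) → g S ≡ 1 ∸ o
g-flip-step₀ {N = N} {S} (_ , _ , _ , g-rec , _) low@(lin@(_ , N<S , _) , _) ih =
  trans (g-rec S (lin-2≤S lin) N (floorCond-step₀ (lower-floorGap low) (upper-floorGap (lower-step₀ low))))
        (cong (1 ∸_) (ih N<S))

g-flip-step₁ : ∀ {g N S o} → IsG g → Upper N S → (N < suc S → g N ≡ o) → g (suc S) ≡ 1 ∸ o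
g-flip-step₁ {N = N} {S} (_ , _ , _ , g-rec , _) up@(lin@(_ , N<S , _) , _) ih =
  trans (g-rec (suc S) (m≤n⇒m≤1+n (lin-2≤S lin)) N
                 (floorCond-step₁ (upper-floorGap up) (lower-floorGap (upper-step₁ up))))
        (cong (1 ∸_) (ih (m<n⇒m<1+n N<S)))

g-otherwise-∷ʳ : ∀ {g} → IsG g → ∀ u d {qu q} → run q0 u ≡ just qu → δ qu d ≡ just q → gap q ≡ 1 →
                 Lin (value u) (shift u) → ¬ (d ≡ true × gap qu ≡ 0) → g (value (u ∷ʳ d)) ≡ 1
g-otherwise-∷ʳ (_ , _ , _ , _ , g-otherwise) u d ru eq gap≡1 lin excluded =
  g-otherwise _ (≤-trans (lin-2≤S lin) (shift≤value-∷ʳ u d))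
    λ m fc → excluded (lower-floorCond⇒upper-∷ʳ-true u d {m = m} hw ru gw fc)
  where
  rw = trans (run-∷ʳ-just u d ru) eq
  hw = run-admissible q0 (u ∷ʳ d) rw
  gw = subst (FloorGap (value (u ∷ʳ d)) (shift (u ∷ʳ d))) gap≡1 (run-floorGap (u ∷ʳ d) rw)

g-∷ʳ : ∀ {g} → IsG g → ∀ u d {qu q} → run q0 u ≡ just qu → δ qu d ≡ just q →
       Invariant qu (value u) (shift u) →
       (value u < value (u ∷ʳ d) → g (value u) ≡ output qu) → g (value (u ∷ʳ d)) ≡ output q
g-∷ʳ {g} (_ , g0 , _) u false {q0} _ refl (_ , S≡0) _ = trans (cong g S≡0) g0
g-∷ʳ {g} (_ , _ , g1 , _) u true {q0} _ refl (_ , S≡0) _ =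
  trans (cong g (trans (value-∷ʳ-true u) (cong suc S≡0))) g1
g-∷ʳ isG u false {q1} _ refl inv ih = g-flip-step₀ isG inv ih
g-∷ʳ isG u false {q3} _ refl inv ih = g-flip-step₀ isG inv ih
g-∷ʳ isG u false {q5} _ refl inv ih = g-flip-step₀ isG inv ih
g-∷ʳ isG u true {q2} _ refl inv ih rewrite value-∷ʳ-true u = g-flip-step₁ isG inv ih
g-∷ʳ isG u true {q4} _ refl inv ih rewrite value-∷ʳ-true u = g-flip-step₁ isG inv ih
g-∷ʳ isG u false {q2} ru refl (lin , _) _ = g-otherwise-∷ʳ isG u false ru refl refl lin λ { (() , _) }
g-∷ʳ isG u false {q4} ru refl (lin , _) _ = g-otherwise-∷ʳ isG u false ru refl refl lin λ { (() , _) }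
g-∷ʳ isG u true {q3} ru refl (lin , _) _ = g-otherwise-∷ʳ isG u true ru refl refl lin λ { (_ , ()) }
g-∷ʳ isG u true {q1} _ ()
g-∷ʳ isG u true {q5} _ ()

g-run : ∀ {g} → IsG g → ∀ w {q} → run q0 w ≡ just q → g (value w) ≡ output q
g-run {g} isG@(_ , g0 , _) w = <-rec P step (value w) w refl
  where
  P : ℕ → Set
  P n = ∀ w {q} → value w ≡ n → run q0 w ≡ just q → g n ≡ output q
  step : ∀ n → (∀ {m} → m < n → P m) → P n
  step n ih w eq r with reverseView w
  step n ih .[] refl refl | [] = g0
  step n ih .(u ∷ʳ d) refl r | u ∶ _ ∶ʳ d with run-∷ʳ⁻ u d r
  ... | qu , ru , eq = g-∷ʳ isG u d ru eq (run-invariant u ru) (λ lt → ih lt u refl ru)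

proposition6 : (g : ℕ → ℕ) → IsG g →
    ∀ (n : ℕ) (w : List Bool) → IsRepF w n → (Accepts w ⇔ g n ≡ 1)
proposition6 g isG n w (refl , _ , admissible) with run-total q0 w admissible
... | q , r rewrite r =
  subst (λ o → Accepting q ⇔ o ≡ 1) (sym (g-run isG w r)) (Accepting⇔output≡1 q)
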